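{- Let $m>1$ and let $C_m$ be the category defined in the context, which is a Möbius category. Its Möbius function $\mu$ is given, for every morphism $(a,\overline{x},i,j)$ of $C_m$, by $$\mu(a,\overline{x},i,j)=\begin{cases}1&\text{if } a=0 \text{ and } j=i,\ \text{or } a=1\text{ and } j=i-2,\\ -1&\text{if } a=0\text{ and } j=i-1,\ \text{or } a=1\text{ and } j=i-1,\\ 0&\text{otherwise.}\end{cases}$$
   Context: Let $m>1$ be an integer, $\mathbb{Z}_m$ the cyclic group of integers modulo $m$ (residue class of an integer $n$ written $\overline{n}$), $\mathbb{Z}_-$ the set of non-positive integers and $\mathbb{Z}_+$ the set of non-negative integers. The category $C_m$ has object set $\mathbb{Z}_m\times\mathbb{Z}_-$; for objects $(\overline{x},i),(\overline{y},j)$, $\mathrm{Hom}_{C_m}((\overline{x},i),(\overline{y},j))=\{(a,\overline{x},i,j)\mid a\in\mathbb{Z}_+,\ a\le i-j,\ \overline{a}+\overline{x}=\overline{y}\}$; composition is $(b,\overline{y},j,k)\circ(a,\overline{x},i,j)=(a+b,\overline{x},i,k)$ (identities are $(0,\overline{x},i,i)$). For a Möbius category $C$ (every morphism has finitely many factorizations $f=g\circ h$, and incidence functions $\xi:\mathrm{Mor}\,C\to\mathbb{C}$ are invertible for the convolution $(\xi*\eta)(f)=\sum_{f=g\circ h}\xi(g)\eta(h)$ exactly when nonzero on identities), the Möbius function $\mu$ is the convolution inverse of the zeta function $\zeta\equiv1$; equivalently $\sum_{f=g\circ h}\mu(g)=\delta(f)$ for all $f$, where $\delta(f)=1$ if $f$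 is an identity and $0$ otherwise. -}

module Defs where

open import Data.Nat as ℕ using (ℕ; zero; suc; NonZero)
open import Data.Nat.DivMod using (_mod_)
open import Data.Fin using (Fin; toℕ)
open import Data.Fin.Properties using () renaming (_≟_ to _≟F_)
open import Data.Integer as ℤ using (ℤ; +_; 0ℤ; 1ℤ; -1ℤ; _-_; _≤_; _≤?_; ∣_∣)
open import Data.Integer.Properties using () renaming (_≟_ to _≟ℤ_)
open import Data.List using (List; map; upTo; foldr; allFin)
open import Data.Product using (_×_; _,_)
open import Relation.Nullary using (Dec; yes; no)
open import Relation.Nullary.Decidable using (_×-dec_)
open import Relation.Binary.PropositionalEquality using (_≡_)

record Obj (m : ℕ) : Set where
  constructor obj
  field
    res     : Fin m
    lvl     : ℤ
    nonpos  : lvl ≤ 0ℤ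
open Obj public

addRes : (m : ℕ) .{{_ : NonZero m}} → ℕ → Fin m → Fin m
addRes m a x = (a ℕ.+ toℕ x) mod m

IsHom : (m : ℕ) .{{_ : NonZero m}} → Obj m → Obj m → ℕ → Set
IsHom m X Y a = (+ a ≤ lvl X - lvl Y) × (addRes m a (res X) ≡ res Y)

isHom? : (m : ℕ) .{{_ : NonZero m}} → (X Y : Obj m) (a : ℕ) → Dec (IsHom m X Y a)
isHom? m X Y a = (+ a ≤? lvl X - lvl Y) ×-dec (addRes m a (res X) ≟F res Y)

-- Morphisms of C_m: a morphism (a, x̄, i, j) : (x̄,i) → (ȳ,j)
record Mor (m : ℕ) .{{_ : NonZero m}} : Set where
  constructor mor
  field
    dom  : Obj m
    cod  : Obj m
    amt  : ℕ
    ok   : IsHom m dom cod amt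
open Mor public

-- composition g ∘ h (for cod h = dom g) is (amt h + amt g, ...).

IncFun : (m : ℕ) .{{_ : NonZero m}} → Set
IncFun m = Mor m → ℤ

sumL : {A : Set} → List A → (A → ℤ) → ℤ
sumL xs f = foldr (λ x s → f x ℤ.+ s) 0ℤ xs

-- Convolution (ξ * η)(f) = Σ_{f = g ∘ h} ξ(g) η(h).
-- For f = (a, x̄, i, j) : X → Y, a factorization f = g ∘ h is given by an
-- intermediate object c = (ȳ, k), a morphism h : X → c of amount b and a
-- morphism g : c → Y of amount a - b (so that composition gives amount a).
-- Any such c has j ≤ k ≤ i, so k ranges over i - t, t = 0 .. |i - j|.
conv : (m : ℕ) .{{_ : NonZero m}} → IncFun m → IncFun m → IncFun m
conv m ξ η f =
  sumL (upTo (suc ∣ lvl X - lvl Y ∣)) λ t →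
  sumL (allFin m) λ y →
  sumL (upTo (suc a)) λ b →
  term (lvl X - + t) y b
  where
  X = dom f
  Y = cod f
  a = amt f
  term : ℤ → Fin m → ℕ → ℤ
  term k y b with k ≤? 0ℤ
  ... | no _ = 0ℤ
  ... | yes k≤0 with isHom? m X (obj y k k≤0) b | isHom? m (obj y k k≤0) Y (a ℕ.∸ b)
  ...   | yes hh | yes gg = ξ (mor (obj y k k≤0) Y (a ℕ.∸ b) gg) ℤ.* η (mor X (obj y k k≤0) b hh)
  ...   | _ | _ = 0ℤ

ζ : (m : ℕ) .{{_ : NonZero m}} → IncFun m
ζ m f = 1ℤ

δ : (m : ℕ) .{{_ : NonZero m}} → IncFun m
δ m f with amt f ℕ.≟ 0 | lvl (cod f) ≟ℤ lvl (dom f)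
... | yes _ | yes _ = 1ℤ
... | _ | _ = 0ℤ

μformula : (m : ℕ) .{{_ : NonZero m}} → IncFun m
μformula m f with amt f | lvl (cod f) ≟ℤ lvl (dom f) | lvl (cod f) ≟ℤ lvl (dom f) - + 1 | lvl (cod f) ≟ℤ lvl (dom f) - + 2
... | 0 | yes _ | _ | _ = 1ℤ
... | 0 | no _ | yes _ | _ = -1ℤ
... | 1 | _ | yes _ | _ = -1ℤ
... | 1 | _ | no _ | yes _ = 1ℤ
... | _ | _ | _ | _ = 0ℤ

{-# OPTIONS --safe #-}
module Submission where

-- The functions μformula, ζ and δ depend on a morphism f = (a, x̄, i, j) only through its amount a and its
-- span d = i - j. A factorisation of f through an object (ȳ, i - t) exists for at most one residue ȳ, and
-- for the amount b of its first factor it exists iff b ≤ t and a - b ≤ d - t. Hence convolution on C_m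
-- becomes convolution of functions on the cone {(a, d) : a ≤ d} ⊆ ℕ², which is commutative. There ζ is the
-- indicator of the cone, whose generating function is Σ_{a ≤ d} xᵃ yᵈ = 1 / ((1 - y)(1 - xy)), and μ is
-- supported on {(0,0), (0,1), (1,1), (1,2)} with the signs of (1 - y)(1 - xy) = 1 - y - xy + xy²; so
-- ζ ⋆ μ = δ only needs to be checked on these four terms.

open import Defs
open import Data.Bool using (if_then_else_)
open import Data.Fin as Fin using (Fin; toℕ)
import Data.Fin.Permutation as Permutation
import Data.Fin.Properties as Fin
open import Data.Integer as ℤ using (ℤ; +_; 0ℤ; 1ℤ; -1ℤ; _+_; _*_; _-_; ∣_∣; _≤?_) renaming (_≤_ to _≤ℤ_)
import Data.Integer.Properties as ℤ
open import Algebra.Properties.CommutativeMonoid.Sum ℤ.+-0-commutativeMonoid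
  using (sum-syntax; sum⁺-syntax; sum-cong-≗; sum-replicate-zero; ∑-comm; ∑-permute)
open import Data.Integer.Tactic.RingSolver using (solve-∀)
open import Data.List using (List; []; _∷_; foldr; applyUpTo; upTo; tabulate; allFin)
open import Data.List.Membership.Propositional using (_∈_)
open import Data.List.Membership.Propositional.Properties using (∈-applyUpTo⁻)
open import Data.List.Relation.Unary.Any using (here; there)
open import Data.Nat as ℕ using (ℕ; zero; suc; _≤_; _<_; _∸_; _⊓_; z≤n; s≤s; NonZero)
import Data.Nat.Properties as ℕ
open import Data.Nat.DivMod using (_mod_; _%_; %-distribˡ-+; m%n%n≡m%n)
open import Data.Product using (_×_; _,_; proj₂)
open import Function using (_∘_)
open import Relation.Binary.PropositionalEquality
open import Relation.Nullary using (does; yes; no; ¬_; contradiction)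
open import Relation.Nullary.Decidable using (dec-true)

∑-zero : ∀ {n} (f : Fin n → ℤ) → (∀ i → f i ≡ 0ℤ) → ∑[ i < n ] f i ≡ 0ℤ
∑-zero {n} f f≡0 = trans (sum-cong-≗ f≡0) (sum-replicate-zero n)

∑-indicator : ∀ {n} (y₀ : Fin n) (v : ℤ) → ∑[ y < n ] (if does (y Fin.≟ y₀) then v else 0ℤ) ≡ v
∑-indicator {suc n} Fin.zero     v = trans (cong (_+_ v) (sum-replicate-zero n)) (ℤ.+-identityʳ v)
∑-indicator {suc n} (Fin.suc y₀) v = trans (ℤ.+-identityˡ _) (∑-indicator y₀ v)

∑-truncate : ∀ n K (g : ℕ → ℤ) → (∀ k → g (K ℕ.+ k) ≡ 0ℤ) → ∑[ i < n ] g (toℕ i) ≡ ∑[ i < K ⊓ n ] g (toℕ i)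
∑-truncate n       zero    g g≡0 = ∑-zero {n} (g ∘ toℕ) (g≡0 ∘ toℕ)
∑-truncate zero    (suc K) g g≡0 = refl
∑-truncate (suc n) (suc K) g g≡0 = cong (_+_ (g 0)) (∑-truncate n K (g ∘ suc) g≡0)

∑-reverse : ∀ n (g : ℕ → ℤ) → ∑[ i ≤ n ] g (toℕ i) ≡ ∑[ i ≤ n ] g (n ∸ toℕ i)
∑-reverse n g = trans (∑-permute (g ∘ toℕ) Permutation.reverse) (sum-cong-≗ (cong g ∘ Fin.opposite-prop))

sumL-applyUpTo : ∀ (g : ℕ → ℕ) n (F : ℕ → ℤ) → sumL (applyUpTo g n) F ≡ ∑[ i < n ] F (g (toℕ i))
sumL-applyUpTo g zero    F = refl
sumL-applyUpTo g (suc n) F = cong (_+_ (F (g 0))) (sumL-applyUpTo (g ∘ suc) n F)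

sumL-tabulate : ∀ {A : Set} {n} (g : Fin n → A) (F : A → ℤ) → sumL (tabulate g) F ≡ ∑[ i < n ] F (g i)
sumL-tabulate {n = zero}  g F = refl
sumL-tabulate {n = suc n} g F = cong (_+_ (F (g Fin.zero))) (sumL-tabulate (g ∘ Fin.suc) F)

foldr-cong : ∀ {A : Set} (xs : List A) {K : A → ℤ → ℤ} (G : A → ℤ) →
             (∀ x s → x ∈ xs → K x s ≡ G x + s) → foldr K 0ℤ xs ≡ sumL xs G
foldr-cong []       G K≡G = refl
foldr-cong (x ∷ xs) G K≡G = trans (K≡G x _ (here refl)) (cong (_+_ (G x)) (foldr-cong xs G λ y s → K≡G y s ∘ there))

-- The first term of sumL (upTo (suc n)) is split off: Agda cannot infer a summand K from the unfolded sum while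
-- its head is an unsolved metavariable, but it can from the fold over the stuck list applyUpTo suc n.
foldr-upTo-suc-cong : ∀ n {h : ℤ} {K : ℕ → ℤ → ℤ} (G : ℕ → ℤ) → h ≡ G 0 → (∀ k s → k ≤ n → K k s ≡ G k + s) →
                      h + foldr K 0ℤ (applyUpTo suc n) ≡ sumL (upTo (suc n)) G
foldr-upTo-suc-cong n G refl K≡G = cong (_+_ (G 0)) (foldr-cong (applyUpTo suc n) G λ k s k∈ → bound k s k∈)
  where
  bound : ∀ k s → k ∈ applyUpTo suc n → _ ≡ G k + s
  bound k s k∈ with _ , i<n , refl ← ∈-applyUpTo⁻ suc k∈ = K≡G k s i<n

-- Convolution on the cone {(a, d) : a ≤ d}

Conic : (ℕ → ℕ → ℤ) → Set
Conic φ = ∀ {p q} → q < p → φ p q ≡ 0ℤ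

_⋆_ : (φ ψ : ℕ → ℕ → ℤ) → ℕ → ℕ → ℤ
(φ ⋆ ψ) a d = ∑[ t ≤ d ] ∑[ b ≤ a ] (φ (a ∸ toℕ b) (d ∸ toℕ t) * ψ (toℕ b) (toℕ t))

⋆-comm : ∀ φ ψ a d → (φ ⋆ ψ) a d ≡ (ψ ⋆ φ) a d
⋆-comm φ ψ a d = begin
  ∑[ t ≤ d ] ∑[ b ≤ a ] (φ (a ∸ toℕ b) (d ∸ toℕ t) * ψ (toℕ b) (toℕ t))
    ≡⟨ ∑-reverse d (λ t → ∑[ b ≤ a ] (φ (a ∸ toℕ b) (d ∸ t) * ψ (toℕ b) t)) ⟩
  ∑[ t ≤ d ] ∑[ b ≤ a ] (φ (a ∸ toℕ b) (d ∸ (d ∸ toℕ t)) * ψ (toℕ b) (d ∸ toℕ t))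
    ≡⟨ sum-cong-≗ {suc d} (λ t → ∑-reverse a (λ b → φ (a ∸ b) (d ∸ (d ∸ toℕ t)) * ψ b (d ∸ toℕ t))) ⟩
  ∑[ t ≤ d ] ∑[ b ≤ a ] (φ (a ∸ (a ∸ toℕ b)) (d ∸ (d ∸ toℕ t)) * ψ (a ∸ toℕ b) (d ∸ toℕ t))
    ≡⟨ sum-cong-≗ {suc d} (λ t → sum-cong-≗ {suc a} (λ b → swap (Fin.toℕ≤pred[n] b) (Fin.toℕ≤pred[n] t))) ⟩
  ∑[ t ≤ d ] ∑[ b ≤ a ] (ψ (a ∸ toℕ b) (d ∸ toℕ t) * φ (toℕ b) (toℕ t)) ∎
  where
  open ≡-Reasoning
  swap : ∀ {b t} → b ≤ a → t ≤ d → φ (a ∸ (a ∸ b)) (d ∸ (d ∸ t)) * ψ (a ∸ b) (d ∸ t) ≡ ψ (a ∸ b) (d ∸ t) * φ b t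
  swap {b} {t} b≤a t≤d rewrite ℕ.m∸[m∸n]≡n b≤a | ℕ.m∸[m∸n]≡n t≤d = ℤ.*-comm (φ b t) (ψ (a ∸ b) (d ∸ t))

ζ₂ : ℕ → ℕ → ℤ
ζ₂ zero    q       = 1ℤ
ζ₂ (suc p) zero    = 0ℤ
ζ₂ (suc p) (suc q) = ζ₂ p q

μ₂ : ℕ → ℕ → ℤ
μ₂ 0 0 = 1ℤ
μ₂ 0 1 = -1ℤ
μ₂ 1 1 = -1ℤ
μ₂ 1 2 = 1ℤ
μ₂ _ _ = 0ℤ

δ₂ : ℕ → ℕ → ℤ
δ₂ 0 0 = 1ℤ
δ₂ _ _ = 0ℤ

ζ₂-≤ : ∀ {p q} → p ≤ q → ζ₂ p q ≡ 1ℤ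
ζ₂-≤ z≤n       = refl
ζ₂-≤ (s≤s p≤q) = ζ₂-≤ p≤q

ζ₂-conic : Conic ζ₂
ζ₂-conic {suc p} {zero}  _         = refl
ζ₂-conic {suc p} {suc q} (s≤s q<p) = ζ₂-conic q<p

μ₂-conic : Conic μ₂
μ₂-conic {suc zero}    {zero}  _           = refl
μ₂-conic {suc zero}    {suc q} (s≤s ())
μ₂-conic {suc (suc p)}         _           = refl

μ₂-vanishes : ∀ b t → μ₂ b (3 ℕ.+ t) ≡ 0ℤ
μ₂-vanishes 0             t = refl
μ₂-vanishes 1             t = refl
μ₂-vanishes (suc (suc b)) t = refl

ζ₂⋆μ₂ : ∀ a d → a ≤ d → (ζ₂ ⋆ μ₂) a d ≡ δ₂ a d
ζ₂⋆μ₂ a d a≤d = begin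
  ∑[ t < suc d ] ∑[ b < suc a ] term (toℕ t) (toℕ b)
    ≡⟨ ∑-truncate (suc d) 3 (λ t → ∑[ b < suc a ] term t (toℕ b))
                  (λ t → ∑-zero {suc a} (term (3 ℕ.+ t) ∘ toℕ) (term-vanishesʳ t ∘ toℕ)) ⟩
  ∑[ t < 3 ⊓ suc d ] ∑[ b < suc a ] term (toℕ t) (toℕ b)
    ≡⟨ sum-cong-≗ {3 ⊓ suc d} (λ t → ∑-truncate (suc a) 2 (term (toℕ t)) (term-vanishesˡ (toℕ t))) ⟩
  ∑[ t < 3 ⊓ suc d ] ∑[ b < 2 ⊓ suc a ] term (toℕ t) (toℕ b)
    ≡⟨ corners a d a≤d ⟩
  δ₂ a d ∎
  where
  open ≡-Reasoning
  term : ℕ → ℕ → ℤ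
  term t b = ζ₂ (a ∸ b) (d ∸ t) * μ₂ b t
  term-vanishesʳ : ∀ t b → term (3 ℕ.+ t) b ≡ 0ℤ
  term-vanishesʳ t b = trans (cong (ζ₂ (a ∸ b) (d ∸ (3 ℕ.+ t)) *_) (μ₂-vanishes b t)) (ℤ.*-zeroʳ (ζ₂ (a ∸ b) (d ∸ (3 ℕ.+ t))))
  term-vanishesˡ : ∀ t b → term t (2 ℕ.+ b) ≡ 0ℤ
  term-vanishesˡ t b = ℤ.*-zeroʳ (ζ₂ (a ∸ (2 ℕ.+ b)) (d ∸ t))
  corners : ∀ a d → a ≤ d →
            ∑[ t < 3 ⊓ suc d ] ∑[ b < 2 ⊓ suc a ] (ζ₂ (a ∸ toℕ b) (d ∸ toℕ t) * μ₂ (toℕ b) (toℕ t)) ≡ δ₂ a d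
  corners 0       0             _           = refl
  corners 0       1             _           = refl
  corners 0       (suc (suc d)) _           = refl
  corners 1       1             _           = refl
  corners (suc a) (suc (suc d)) (s≤s a≤1+d) rewrite ζ₂-≤ a≤1+d =
    cancel (ζ₂ a (suc (suc d))) (ζ₂ (suc a) d) (ζ₂ a d)
    where
    -- (b, t) = (0, 0) and (1, 1) contribute 1 and -1, and (0, 1) and (1, 2) contribute ∓ ζ₂ a d.
    cancel : ∀ x y c → (1ℤ * 1ℤ + (x * 0ℤ + 0ℤ)) + ((c * -1ℤ + (1ℤ * -1ℤ + 0ℤ)) + ((y * 0ℤ + (c * 1ℤ + 0ℤ)) + 0ℤ)) ≡ 0ℤ
    cancel = solve-∀

i-[i-j]≡j : ∀ i j → i - (i - j) ≡ j
i-[i-j]≡j = solve-∀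

[i-k]-j≡[i-j]-k : ∀ i j k → (i - k) - j ≡ (i - j) - k
[i-k]-j≡[i-j]-k = solve-∀

span : ∀ {m} .{{_ : NonZero m}} → Mor m → ℕ
span f = ∣ lvl (dom f) - lvl (cod f) ∣

module _ {m : ℕ} .{{_ : NonZero m}} where

  dom-cod-levels : ∀ f → lvl (dom f) - lvl (cod f) ≡ + span f
  dom-cod-levels (mor _ _ _ (a≤i-j , _)) = sym (ℤ.0≤i⇒+∣i∣≡i (ℤ.≤-trans (ℤ.+≤+ z≤n) a≤i-j))

  cod-level : ∀ f → lvl (cod f) ≡ lvl (dom f) - + span f
  cod-level f = trans (sym (i-[i-j]≡j (lvl (dom f)) (lvl (cod f)))) (cong (lvl (dom f) -_) (dom-cod-levels f))

  span≡ : ∀ f {k} → lvl (cod f) ≡ lvl (dom f) - + k → span f ≡ k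
  span≡ f {k} j≡i-k = ℤ.+-injective (begin
    + span f                          ≡⟨ dom-cod-levels f ⟨
    lvl (dom f) - lvl (cod f)         ≡⟨ cong (lvl (dom f) -_) j≡i-k ⟩
    lvl (dom f) - (lvl (dom f) - + k) ≡⟨ i-[i-j]≡j (lvl (dom f)) (+ k) ⟩
    + k                               ∎)
    where open ≡-Reasoning

  span≢ : ∀ f {k} → lvl (cod f) ≢ lvl (dom f) - + k → span f ≢ k
  span≢ f j≢i-k refl = j≢i-k (cod-level f)

  amt≤span : ∀ f → amt f ≤ span f
  amt≤span f@(mor _ _ a (a≤i-j , _)) = ℤ.drop‿+≤+ (subst (+ a ≤ℤ_) (dom-cod-levels f) a≤i-j)

  lower-level : ∀ f {t} → t ≤ span f → (lvl (dom f) - + t) - lvl (cod f) ≡ + (span f ∸ t)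
  lower-level f {t} t≤d = begin
    (lvl (dom f) - + t) - lvl (cod f) ≡⟨ [i-k]-j≡[i-j]-k (lvl (dom f)) (lvl (cod f)) (+ t) ⟩
    (lvl (dom f) - lvl (cod f)) - + t ≡⟨ cong (_- + t) (dom-cod-levels f) ⟩
    + span f - + t                    ≡⟨ ℤ.[+m]-[+n]≡m⊖n (span f) t ⟩
    span f ℤ.⊖ t                      ≡⟨ ℤ.⊖-≥ t≤d ⟩
    + (span f ∸ t)                    ∎
    where open ≡-Reasoning

  addRes-addRes : ∀ p q (x : Fin m) → addRes m p (addRes m q x) ≡ addRes m (p ℕ.+ q) x
  addRes-addRes p q x = Fin.toℕ-injective (begin
    toℕ ((p ℕ.+ toℕ ((q ℕ.+ toℕ x) mod m)) mod m) ≡⟨ Fin.toℕ-fromℕ< _ ⟩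
    (p ℕ.+ toℕ ((q ℕ.+ toℕ x) mod m)) % m         ≡⟨ cong (λ r → (p ℕ.+ r) % m) (Fin.toℕ-fromℕ< _) ⟩
    (p ℕ.+ (q ℕ.+ toℕ x) % m) % m                 ≡⟨ %-distribˡ-+ p _ m ⟩
    (p % m ℕ.+ (q ℕ.+ toℕ x) % m % m) % m         ≡⟨ cong (λ r → (p % m ℕ.+ r) % m) (m%n%n≡m%n _ m) ⟩
    (p % m ℕ.+ (q ℕ.+ toℕ x) % m) % m             ≡⟨ %-distribˡ-+ p _ m ⟨
    (p ℕ.+ (q ℕ.+ toℕ x)) % m                     ≡⟨ cong (_% m) (ℕ.+-assoc p q (toℕ x)) ⟨
    (p ℕ.+ q ℕ.+ toℕ x) % m                       ≡⟨ Fin.toℕ-fromℕ< _ ⟨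
    toℕ ((p ℕ.+ q ℕ.+ toℕ x) mod m)               ∎)
    where open ≡-Reasoning

-- Convolution of functions of amount and span

module Reduction {m : ℕ} .{{_ : NonZero m}} {ξ η : IncFun m} {φ ψ : ℕ → ℕ → ℤ}
                 (ξ≗φ : ∀ f → ξ f ≡ φ (amt f) (span f)) (η≗ψ : ∀ f → η f ≡ ψ (amt f) (span f))
                 (φ-conic : Conic φ) (ψ-conic : Conic ψ) where

  summand : Mor m → ℕ → Fin m → ℕ → ℤ
  summand f t y b =
    if does (y Fin.≟ addRes m b (res (dom f))) then φ (amt f ∸ b) (span f ∸ t) * ψ b t else 0ℤ

  module _ (f : Mor m) {t : ℕ} (y : Fin m) (t≤d : t ≤ span f) (i-t≤0 : lvl (dom f) - + t ≤ℤ 0ℤ) where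

    private
      X = dom f
      Y = cod f
      a = amt f
      c = obj y (lvl X - + t) i-t≤0

    summand-factors : ∀ {b} (h : IsHom m X c b) (g : IsHom m c Y (a ∸ b)) →
                      ξ (mor c Y (a ∸ b) g) * η (mor X c b h) ≡ summand f t y b
    summand-factors {b} (_ , b+x≡y) _ rewrite dec-true (y Fin.≟ addRes m b (res X)) (sym b+x≡y) =
      cong₂ _*_ (trans (ξ≗φ _) (cong (φ (a ∸ b) ∘ ∣_∣) (lower-level f t≤d)))
                (trans (η≗ψ _) (cong (ψ b ∘ ∣_∣) (i-[i-j]≡j (lvl X) (+ t))))

    summand-no-cod : ∀ {b} → b ≤ a → IsHom m X c b → ¬ IsHom m c Y (a ∸ b) → 0ℤ ≡ summand f t y b
    summand-no-cod {b} b≤a (_ , b+x≡y) ¬g rewrite dec-true (y Fin.≟ addRes m b (res X)) (sym b+x≡y) =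
      sym (trans (cong (_* ψ b t) (φ-conic (ℕ.≰⇒> λ a-b≤d-t → ¬g (lift a-b≤d-t , residue)))) (ℤ.*-zeroˡ (ψ b t)))
      where
      lift : a ∸ b ≤ span f ∸ t → + (a ∸ b) ≤ℤ (lvl X - + t) - lvl Y
      lift a-b≤d-t = subst (+ (a ∸ b) ≤ℤ_) (sym (lower-level f t≤d)) (ℤ.+≤+ a-b≤d-t)
      residue : addRes m (a ∸ b) y ≡ res Y
      residue = begin
        addRes m (a ∸ b) y                    ≡⟨ cong (addRes m (a ∸ b)) b+x≡y ⟨
        addRes m (a ∸ b) (addRes m b (res X)) ≡⟨ addRes-addRes (a ∸ b) b (res X) ⟩
        addRes m (a ∸ b ℕ.+ b) (res X)        ≡⟨ cong (λ n → addRes m n (res X)) (ℕ.m∸n+n≡m b≤a) ⟩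
        addRes m a (res X)                    ≡⟨ proj₂ (ok f) ⟩
        res Y                                 ∎
        where open ≡-Reasoning

    summand-no-dom : ∀ {b} → ¬ IsHom m X c b → 0ℤ ≡ summand f t y b
    summand-no-dom {b} ¬h with y Fin.≟ addRes m b (res X)
    ... | no _      = refl
    ... | yes y≡b+x = sym (trans (cong (φ (a ∸ b) (span f ∸ t) *_) (ψ-conic (ℕ.≰⇒> λ b≤t → ¬h (lift b≤t , sym y≡b+x))))
                                 (ℤ.*-zeroʳ (φ (a ∸ b) (span f ∸ t))))
      where
      lift : b ≤ t → + b ≤ℤ lvl X - (lvl X - + t)
      lift b≤t = subst (+ b ≤ℤ_) (sym (i-[i-j]≡j (lvl X) (+ t))) (ℤ.+≤+ b≤t)

  -- The left-hand sides _ are sums and summands local to the where-block of conv, which cannot be named: they are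
  -- inferred from the uses below, and the proofs inspect the same decisions as conv. The first summand (b = 0) is
  -- decided in conv-via-object itself, to hand foldr-upTo-suc-cong an explicit head term.
  conv-via-object : ∀ f t y s → t ≤ span f → _ ≡ sumL (upTo (suc (amt f))) (summand f t y) + s
  conv-summand : ∀ f t y (i-t≤0 : lvl (dom f) - + t ≤ℤ 0ℤ) b s → t ≤ span f → b ≤ amt f → _ ≡ summand f t y b + s

  conv-as-sumL : ∀ f → conv m ξ η f ≡
    sumL (upTo (suc (span f))) λ t → sumL (allFin m) λ y → sumL (upTo (suc (amt f))) (summand f t y)
  conv-as-sumL f = foldr-upTo-suc-cong (span f) (λ t → sumL (allFin m) (via-object t))
    (foldr-cong (allFin m) (via-object 0) λ y s _ → conv-via-object f 0 y s z≤n)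
    (λ t s t≤d → cong (_+ s) (foldr-cong (allFin m) (via-object t) λ y s′ _ → conv-via-object f t y s′ t≤d))
    where
    via-object : ℕ → Fin m → ℤ
    via-object t y = sumL (upTo (suc (amt f))) (summand f t y)

  conv-via-object f t y s t≤d with lvl (dom f) - + t ≤? 0ℤ
  ... | no i-t≰0 = contradiction (ℤ.≤-trans (ℤ.i-j≤i (lvl (dom f)) (+ t)) (nonpos (dom f))) i-t≰0
  ... | yes i-t≤0 with isHom? m (dom f) (obj y (lvl (dom f) - + t) i-t≤0) 0
                     | isHom? m (obj y (lvl (dom f) - + t) i-t≤0) (cod f) (amt f ∸ 0)
  ... | yes h | yes g = cong (_+ s) (foldr-upTo-suc-cong (amt f) (summand f t y) (summand-factors f y t≤d i-t≤0 h g)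
                          λ b s′ b≤a → conv-summand f t y i-t≤0 b s′ t≤d b≤a)
  ... | yes h | no ¬g = cong (_+ s) (foldr-upTo-suc-cong (amt f) (summand f t y) (summand-no-cod f y t≤d i-t≤0 z≤n h ¬g)
                          λ b s′ b≤a → conv-summand f t y i-t≤0 b s′ t≤d b≤a)
  ... | no ¬h | _     = cong (_+ s) (foldr-upTo-suc-cong (amt f) (summand f t y) (summand-no-dom f y t≤d i-t≤0 ¬h)
                          λ b s′ b≤a → conv-summand f t y i-t≤0 b s′ t≤d b≤a)

  conv-summand f t y i-t≤0 b s t≤d b≤a with isHom? m (dom f) (obj y (lvl (dom f) - + t) i-t≤0) b
                                           | isHom? m (obj y (lvl (dom f) - + t) i-t≤0) (cod f) (amt f ∸ b)
  ... | yes h | yes g = cong (_+ s) (summand-factors f y t≤d i-t≤0 h g)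
  ... | yes h | no ¬g = cong (_+ s) (summand-no-cod f y t≤d i-t≤0 b≤a h ¬g)
  ... | no ¬h | _     = cong (_+ s) (summand-no-dom f y t≤d i-t≤0 ¬h)

  conv-reduces : ∀ f → conv m ξ η f ≡ (φ ⋆ ψ) (amt f) (span f)
  conv-reduces f = begin
    conv m ξ η f
      ≡⟨ conv-as-sumL f ⟩
    sumL (upTo (suc d)) (λ t → sumL (allFin m) λ y → sumL (upTo (suc a)) (summand f t y))
      ≡⟨ sumL-applyUpTo (λ t → t) (suc d) (λ t → sumL (allFin m) λ y → sumL (upTo (suc a)) (summand f t y)) ⟩
    ∑[ t ≤ d ] sumL (allFin m) (λ y → sumL (upTo (suc a)) (summand f (toℕ t) y))
      ≡⟨ sum-cong-≗ {suc d} (λ t → trans (sumL-tabulate (λ y → y) (λ y → sumL (upTo (suc a)) (summand f (toℕ t) y)))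
                                         (sum-cong-≗ {m} λ y → sumL-applyUpTo (λ b → b) (suc a) (summand f (toℕ t) y))) ⟩
    ∑[ t ≤ d ] ∑[ y < m ] ∑[ b ≤ a ] summand f (toℕ t) y (toℕ b)
      ≡⟨ sum-cong-≗ {suc d} (λ t → ∑-comm {m} {suc a} (λ y b → summand f (toℕ t) y (toℕ b))) ⟩
    ∑[ t ≤ d ] ∑[ b ≤ a ] ∑[ y < m ] summand f (toℕ t) y (toℕ b)
      ≡⟨ sum-cong-≗ {suc d} (λ t → sum-cong-≗ {suc a} (λ b →
           ∑-indicator (addRes m (toℕ b) (res (dom f))) (φ (a ∸ toℕ b) (d ∸ toℕ t) * ψ (toℕ b) (toℕ t)))) ⟩
    (φ ⋆ ψ) a d ∎
    where
    open ≡-Reasoning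
    a = amt f
    d = span f

-- ζ, δ and the claimed μ as functions of amount and span

module _ {m : ℕ} .{{_ : NonZero m}} where

  ζ≗ζ₂ : ∀ f → ζ m f ≡ ζ₂ (amt f) (span f)
  ζ≗ζ₂ f = sym (ζ₂-≤ (amt≤span f))

  δ≗δ₂ : ∀ f → δ m f ≡ δ₂ (amt f) (span f)
  δ≗δ₂ f with amt f ℕ.≟ 0 | lvl (cod f) ℤ.≟ lvl (dom f)
  ... | yes refl | yes j≡i = cong (δ₂ 0) (sym (span≡ f {0} (trans j≡i (sym (ℤ.+-identityʳ _)))))
  ... | yes refl | no j≢i  = δ₂-span-≢0 (span≢ f (λ j≡i-0 → j≢i (trans j≡i-0 (ℤ.+-identityʳ _))))
    where
    δ₂-span-≢0 : ∀ {d} → d ≢ 0 → 0ℤ ≡ δ₂ 0 d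
    δ₂-span-≢0 {zero}  d≢0 = contradiction refl d≢0
    δ₂-span-≢0 {suc d} _   = refl
  ... | no a≢0   | _       = δ₂-amt-≢0 a≢0
    where
    δ₂-amt-≢0 : ∀ {a d} → a ≢ 0 → 0ℤ ≡ δ₂ a d
    δ₂-amt-≢0 {zero}  a≢0 = contradiction refl a≢0
    δ₂-amt-≢0 {suc a} _   = refl

  μformula≗μ₂ : ∀ f → μformula m f ≡ μ₂ (amt f) (span f)
  μformula≗μ₂ f with amt f | lvl (cod f) ℤ.≟ lvl (dom f) | lvl (cod f) ℤ.≟ lvl (dom f) - + 1 | lvl (cod f) ℤ.≟ lvl (dom f) - + 2
  ... | 0           | yes j≡i | _         | _         = cong (μ₂ 0) (sym (span≡ f {0} (trans j≡i (sym (ℤ.+-identityʳ _)))))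
  ... | 0           | no _    | yes j≡i-1 | _         = cong (μ₂ 0) (sym (span≡ f j≡i-1))
  ... | 0           | no j≢i  | no j≢i-1  | _         = μ₂-0 (span≢ f λ j≡i-0 → j≢i (trans j≡i-0 (ℤ.+-identityʳ _))) (span≢ f j≢i-1)
    where
    μ₂-0 : ∀ {d} → d ≢ 0 → d ≢ 1 → 0ℤ ≡ μ₂ 0 d
    μ₂-0 {0}           d≢0 _   = contradiction refl d≢0
    μ₂-0 {1}           _   d≢1 = contradiction refl d≢1
    μ₂-0 {suc (suc d)} _   _   = refl
  ... | 1           | _       | yes j≡i-1 | _         = cong (μ₂ 1) (sym (span≡ f j≡i-1))
  ... | 1           | _       | no _      | yes j≡i-2 = cong (μ₂ 1) (sym (span≡ f j≡i-2))
  ... | 1           | _       | no j≢i-1  | no j≢i-2  = μ₂-1 (span≢ f j≢i-1) (span≢ f j≢i-2)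
    where
    μ₂-1 : ∀ {d} → d ≢ 1 → d ≢ 2 → 0ℤ ≡ μ₂ 1 d
    μ₂-1 {0}                 _   _   = refl
    μ₂-1 {1}                 d≢1 _   = contradiction refl d≢1
    μ₂-1 {2}                 _   d≢2 = contradiction refl d≢2
    μ₂-1 {suc (suc (suc d))} _   _   = refl
  ... | suc (suc _) | _       | _         | _         = refl

proposition3p5 : (m : ℕ) .{{_ : NonZero m}} → 1 < m →
    ((f : Mor m) → conv m (μformula m) (ζ m) f ≡ δ m f) ×
    ((f : Mor m) → conv m (ζ m) (μformula m) f ≡ δ m f)
proposition3p5 m _ = μ⋆ζ≡δ , ζ⋆μ≡δ
  where
  open ≡-Reasoning
  μ⋆ζ≡δ : ∀ f → conv m (μformula m) (ζ m) f ≡ δ m f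
  μ⋆ζ≡δ f = begin
    conv m (μformula m) (ζ m) f       ≡⟨ Reduction.conv-reduces μformula≗μ₂ ζ≗ζ₂ μ₂-conic ζ₂-conic f ⟩
    (μ₂ ⋆ ζ₂) (amt f) (span f)        ≡⟨ ⋆-comm μ₂ ζ₂ (amt f) (span f) ⟩
    (ζ₂ ⋆ μ₂) (amt f) (span f)        ≡⟨ ζ₂⋆μ₂ (amt f) (span f) (amt≤span f) ⟩
    δ₂ (amt f) (span f)               ≡⟨ δ≗δ₂ f ⟨
    δ m f                             ∎
  ζ⋆μ≡δ : ∀ f → conv m (ζ m) (μformula m) f ≡ δ m f
  ζ⋆μ≡δ f = begin
    conv m (ζ m) (μformula m) f       ≡⟨ Reduction.conv-reduces ζ≗ζ₂ μformula≗μ₂ ζ₂-conic μ₂-conic f ⟩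
    (ζ₂ ⋆ μ₂) (amt f) (span f)        ≡⟨ ζ₂⋆μ₂ (amt f) (span f) (amt≤span f) ⟩
    δ₂ (amt f) (span f)               ≡⟨ δ≗δ₂ f ⟨
    δ m f                             ∎
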